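{- Let $s\ge 3$ and let $(G,W,k)$ be an instance of Seeded $s$-Club in which $W$ is a clique in $G$. If $|N_{\lfloor (s+1)/2\rfloor-1}[W]|\ge k$, then $(G,W,k)$ is a yes-instance.
   Context: Seeded $s$-Club: given an undirected graph $G=(V,E)$, a set $W\subseteq V$ and an integer $k\ge 1$, decide whether $G$ contains a vertex set $S$ with $W\subseteq S$, $|S|\ge k$, and $G[S]$ of diameter at most $s$. For $W\subseteq V$ and $i\ge 0$, $N_i[W]$ denotes the set of vertices $u$ with $\min_{w\in W}\mathrm{dist}_G(u,w)\le i$. -}

module Defs where

open import Data.Nat using (ℕ; zero; suc; _≤_; _+_)
open import Data.Fin using (Fin)
open import Data.Fin.Subset using (Subset; _∈_; _⊆_)
open import Data.Product using (Σ; ∃; _×_; _,_)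
open import Relation.Binary.PropositionalEquality using (_≡_)
open import Relation.Nullary using (¬_)
open import Level using (Level; _⊔_) renaming (suc to lsuc; zero to lzero)

record Graph (n : ℕ) : Set₁ where
  field
    Adj     : Fin n → Fin n → Set
    irrefl  : ∀ u → ¬ Adj u u
    sym     : ∀ u v → Adj u v → Adj v u
open Graph public

data WalkIn {n : ℕ} (G : Graph n) (S : Subset n) : Fin n → Fin n → ℕ → Set where
  [] : ∀ {u} → u ∈ S → WalkIn G S u u zero
  _∷_ : ∀ {u v w l} → (u ∈ S × Adj G u v) → WalkIn G S v w l → WalkIn G S u w (suc l)

DistLe : {n : ℕ} → Graph n → Subset n → Fin n → Fin n → ℕ → Set
DistLe G S u v d = Σ ℕ λ l → l ≤ d × WalkIn G S u v l

Full : (n : ℕ) → Subset n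
Full n = Data.Fin.Subset.⊤

DiamLe : {n : ℕ} → Graph n → Subset n → ℕ → Set
DiamLe G S s = ∀ u v → u ∈ S → v ∈ S → DistLe G S u v s

IsClique : {n : ℕ} → Graph n → Subset n → Set
IsClique G W = ∀ u v → u ∈ W → v ∈ W → ¬ (u ≡ v) → Adj G u v

IsClosedNbhd : {n : ℕ} → Graph n → Subset n → ℕ → Subset n → Set
IsClosedNbhd {n} G W i N =
  ∀ u → (u ∈ N → Σ (Fin n) λ w → w ∈ W × DistLe G (Full n) u w i)
      × ((Σ (Fin n) λ w → w ∈ W × DistLe G (Full n) u w i) → u ∈ N)

SeededClubYes : {n : ℕ} → ℕ → Graph n → Subset n → ℕ → Set
SeededClubYes {n} s G W k =
  Σ (Subset n) λ S → W ⊆ S × k ≤ Data.Fin.Subset.∣ S ∣ × DiamLe G S s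

module Submission where

open import Defs
open import Data.Nat using (ℕ; zero; suc; z≤n; s≤s; _≤_; _∸_; _/_; _+_; _*_)
open import Data.Nat.Properties using (≤-trans; ≤-pred; n≤1+n; +-mono-≤; +-monoʳ-≤; +-comm; +-suc; *-comm; +-identityʳ)
open import Data.Nat.DivMod using (m/n*n≤m)
open import Data.Fin using (_≟_)
open import Data.Fin.Subset using (Subset; ∣_∣; _∈_)
open import Data.Fin.Subset.Properties using (∈⊤)
open import Data.Product using (_,_; proj₁; proj₂)
open import Relation.Nullary using (yes; no)
open import Relation.Binary.PropositionalEquality using (_≡_; refl; trans; cong; subst) renaming (sym to ≡-sym)

-- Every vertex of N_i[W] lies within distance i of some w ∈ W along a walk inside
-- N_i[W], and distinct seeds are adjacent; so any two vertices of N_i[W] are joined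
-- inside N_i[W] by a walk of length at most i + 1 + i.  For i = ⌊(s+1)/2⌋ - 1 this
-- is at most s, so N_i[W] itself is the required s-club.

module _ {n : ℕ} {G : Graph n} {S : Subset n} where

  WalkIn-head : ∀ {u v l} → WalkIn G S u v l → u ∈ S
  WalkIn-head ([] u∈S)         = u∈S
  WalkIn-head ((u∈S , _) ∷ _) = u∈S

  _++ʷ_ : ∀ {u v w a b} → WalkIn G S u v a → WalkIn G S v w b → WalkIn G S u w (a + b)
  [] _    ++ʷ q = q
  (e ∷ p) ++ʷ q = e ∷ (p ++ʷ q)

  reverseʷ : ∀ {u v l} → WalkIn G S u v l → WalkIn G S v u l
  reverseʷ ([] u∈S) = [] u∈S
  reverseʷ {l = suc l} ((u∈S , uv) ∷ p) =
    subst (WalkIn G S _ _) (+-comm l 1)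
      (reverseʷ p ++ʷ ((WalkIn-head p , Graph.sym G _ _ uv) ∷ [] u∈S))

DiamLe-mono : ∀ {n} {G : Graph n} {S : Subset n} {s t} → s ≤ t → DiamLe G S s → DiamLe G S t
DiamLe-mono s≤t diam u v u∈S v∈S with diam u v u∈S v∈S
... | l , l≤s , p = l , ≤-trans l≤s s≤t , p

module ClosedNbhd {n : ℕ} {G : Graph n} {W : Subset n} {i : ℕ} {N : Subset n}
                  (isN : IsClosedNbhd G W i N) where

  ∈-closedNbhd : ∀ {u w l} → w ∈ W → l ≤ i → WalkIn G (Full n) u w l → u ∈ N
  ∈-closedNbhd w∈W l≤i p = proj₂ (isN _) (_ , w∈W , _ , l≤i , p)

  seeds⊆closedNbhd : ∀ {w} → w ∈ W → w ∈ N
  seeds⊆closedNbhd w∈W = ∈-closedNbhd w∈W z≤n ([] ∈⊤)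

  -- Each suffix of a short walk to W is again a short walk to W.
  walk-inside : ∀ {u w l} → w ∈ W → l ≤ i → WalkIn G (Full n) u w l → WalkIn G N u w l
  walk-inside w∈W _   ([] _)     = [] (seeds⊆closedNbhd w∈W)
  walk-inside w∈W l≤i (e ∷ p) =
    (∈-closedNbhd w∈W l≤i (e ∷ p) , proj₂ e) ∷ walk-inside w∈W (≤-trans (n≤1+n _) l≤i) p

  closedNbhd-diam : IsClique G W → DiamLe G N (i + suc i)
  closedNbhd-diam clique u v u∈N v∈N with proj₁ (isN u) u∈N | proj₁ (isN v) v∈N
  ... | w , w∈W , a , a≤i , p | w′ , w′∈W , b , b≤i , q with w ≟ w′
  ... | yes refl = a + b , ≤-trans (+-mono-≤ a≤i b≤i) (+-monoʳ-≤ i (n≤1+n i))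
                 , walk-inside w∈W a≤i p ++ʷ reverseʷ (walk-inside w′∈W b≤i q)
  ... | no w≢w′  = a + suc b , +-mono-≤ a≤i (s≤s b≤i)
                 , walk-inside w∈W a≤i p
                   ++ʷ ((seeds⊆closedNbhd w∈W , clique w w′ w∈W w′∈W w≢w′)
                        ∷ reverseʷ (walk-inside w′∈W b≤i q))

halfRadius-bound : ∀ s → 1 ≤ s → let i = ((s + 1) / 2) ∸ 1 in i + suc i ≤ s
halfRadius-bound s 1≤s =
  bound ((s + 1) / 2) (subst (λ m → (s + 1) / 2 * 2 ≤ m) (+-comm s 1) (m/n*n≤m (s + 1) 2))
  where
  double : ∀ r → r + suc r ≡ suc (r * 2)
  double r = trans (+-suc r r) (cong suc (≡-sym (trans (*-comm r 2) (cong (r +_) (+-identityʳ r)))))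

  bound : ∀ q → q * 2 ≤ suc s → (q ∸ 1) + suc (q ∸ 1) ≤ s
  bound zero    _  = 1≤s
  bound (suc r) 2q≤ = subst (_≤ s) (≡-sym (double r)) (≤-pred 2q≤)

lemma10 : (s : ℕ) → 3 ≤ s → (n : ℕ) → (G : Graph n) → (W : Subset n) → (k : ℕ) → 1 ≤ k
    → IsClique G W
    → (N : Subset n) → IsClosedNbhd G W (((s + 1) / 2) ∸ 1) N
    → k ≤ ∣ N ∣
    → SeededClubYes s G W k
lemma10 s 3≤s n G W k _ clique N isN k≤∣N∣ =
  N , seeds⊆closedNbhd , k≤∣N∣
    , DiamLe-mono (halfRadius-bound s (≤-trans (s≤s z≤n) 3≤s)) (closedNbhd-diam clique)
  where open ClosedNbhd isN
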